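{- Let $G$ be an msp-digraph. Then $\chi(\mathrm{un}(G))\leq 3$.
   Context: A source is a vertex of indegree $0$, a sink a vertex of outdegree $0$. For vertex-disjoint digraphs $G_1=(V_1,E_1)$, $G_2=(V_2,E_2)$, let $O_1$ be the set of sinks of $G_1$ and $I_2$ the set of sources of $G_2$. The parallel composition is $G_1\cup G_2=(V_1\cup V_2,E_1\cup E_2)$; the series composition is $G_1\times G_2=(V_1\cup V_2,E_1\cup E_2\cup\{(v,w)\mid v\in O_1, w\in I_2\})$. Msp-digraphs are defined recursively: every single-vertex digraph is an msp-digraph, and if $G_1,G_2$ are vertex-disjoint msp-digraphs then $G_1\cup G_2$ and $G_1\times G_2$ are msp-digraphs. $\mathrm{un}(G)=(V,\{\{u,v\}\mid (u,v)\in E\})$ is the underlying undirected graph and $\chi$ the usual chromatic number. -}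

module Defs where

open import Data.Nat using (ℕ)
open import Data.Fin using (Fin; splitAt)
open import Data.Sum using (_⊎_; inj₁; inj₂)
open import Data.Empty using (⊥)
open import Data.Product using (_×_; ∃)
open import Relation.Nullary using (¬_)
open import Relation.Binary.PropositionalEquality using (_≢_)
open import Function.Bundles using (_↔_; _⇔_; Inverse)

Digraph : ℕ → Set₁
Digraph n = Fin n → Fin n → Set

IsSource : ∀ {n} → Digraph n → Fin n → Set
IsSource E w = ∀ v → ¬ E v w

IsSink : ∀ {n} → Digraph n → Fin n → Set
IsSink E v = ∀ w → ¬ E v w

single : Digraph 1
single _ _ = ⊥

-- Disjoint union of vertex sets: Fin (m + n), the first m vertices from G₁,
-- the last n from G₂.  Arcs of the parallel composition:
_∪ᵈ_ : ∀ {m n} → Digraph m → Digraph n → Digraph (m Data.Nat.+ n)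
_∪ᵈ_ {m} {n} E₁ E₂ u v with splitAt m u | splitAt m v
... | inj₁ i | inj₁ j = E₁ i j
... | inj₂ i | inj₂ j = E₂ i j
... | inj₁ _ | inj₂ _ = ⊥
... | inj₂ _ | inj₁ _ = ⊥

_×ᵈ_ : ∀ {m n} → Digraph m → Digraph n → Digraph (m Data.Nat.+ n)
_×ᵈ_ {m} {n} E₁ E₂ u v with splitAt m u | splitAt m v
... | inj₁ i | inj₁ j = E₁ i j
... | inj₂ i | inj₂ j = E₂ i j
... | inj₁ i | inj₂ j = IsSink E₁ i × IsSource E₂ j
... | inj₂ _ | inj₁ _ = ⊥

-- Msp-digraphs (up to isomorphism, i.e. relabelling of vertices).
data MSP : (n : ℕ) → Digraph n → Set₁ where
  msp-single : MSP 1 single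
  msp-par    : ∀ {m n E₁ E₂} → MSP m E₁ → MSP n E₂ → MSP (m Data.Nat.+ n) (E₁ ∪ᵈ E₂)
  msp-ser    : ∀ {m n E₁ E₂} → MSP m E₁ → MSP n E₂ → MSP (m Data.Nat.+ n) (E₁ ×ᵈ E₂)
  msp-iso    : ∀ {n E E'} → MSP n E → (σ : Fin n ↔ Fin n) →
               (∀ i j → E' (Inverse.to σ i) (Inverse.to σ j) ⇔ E i j) → MSP n E'

un : ∀ {n} → Digraph n → Fin n → Fin n → Set
un E u v = E u v ⊎ E v u

ProperColouring : ∀ {n} (k : ℕ) → (Fin n → Fin n → Set) → (Fin n → Fin k) → Set
ProperColouring k Adj c = ∀ u v → Adj u v → c u ≢ c v

χ≤ : ∀ {n} → (Fin n → Fin n → Set) → ℕ → Set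
χ≤ {n} Adj k = ∃ λ (c : Fin n → Fin k) → ProperColouring k Adj c

{-# OPTIONS --safe #-}
-- Strengthen the claim: for any two distinct colours s ≢ t there is a proper
-- 3-colouring giving every source the colour s and no sink the colour t.
-- For a parallel composition combine two such colourings with the same s, t.
-- For a series composition G₁ × G₂ pick a third colour z, colour G₁ with (s, z)
-- and G₂ with (z, t): a new arc runs from a sink of G₁ (colour ≢ z) to a source
-- of G₂ (colour z).  Since G₁ has a sink and G₂ a source, the sources of
-- G₁ × G₂ are those of G₁ and its sinks those of G₂.
module Submission where

open import Level using (0ℓ)
open import Data.Nat using (ℕ; _+_)
open import Data.Fin using (Fin; zero; suc; join)
open import Data.Fin.Properties using (+↔⊎; splitAt-join)
open import Data.Sum using (_⊎_; inj₁; inj₂; [_,_]′)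
open import Data.Empty using (⊥; ⊥-elim)
open import Data.Product using (_×_; _,_; ∃; proj₁; proj₂)
open import Relation.Nullary using (¬_)
open import Relation.Binary.Core using (Rel)
open import Relation.Binary.PropositionalEquality using (_≡_; _≢_; refl; sym; trans; subst; subst₂)
open import Function.Base using (_∘_)
open import Function.Bundles using (_↔_; _⇔_; Inverse; Equivalence)
open import Function.Construct.Symmetry using (↔-sym)
open import Function.Construct.Identity using (⇔-id)
open import Defs

module _ {V : Set} (E : Rel V 0ℓ) where

  Source : V → Set
  Source w = ∀ v → ¬ E v w

  Sink : V → Set
  Sink v = ∀ w → ¬ E v w

  HasSourceAndSink : Set
  HasSourceAndSink = ∃ Source × ∃ Sink

  Proper : (V → Fin 3) → Set
  Proper c = ∀ u v → E u v → c u ≢ c v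

  record Anchored (s t : Fin 3) (c : V → Fin 3) : Set where
    field
      proper  : Proper c
      sources : ∀ w → Source w → c w ≡ s
      sinks   : ∀ v → Sink v → c v ≢ t

  AnchoredColourable : Set
  AnchoredColourable = ∀ {s t} → s ≢ t → ∃ (Anchored s t)

open Anchored

third : (x y : Fin 3) → ∃ λ z → z ≢ x × z ≢ y
third zero             zero             = suc zero , (λ ()) , (λ ())
third zero             (suc zero)       = suc (suc zero) , (λ ()) , (λ ())
third zero             (suc (suc zero)) = suc zero , (λ ()) , (λ ())
third (suc zero)       zero             = suc (suc zero) , (λ ()) , (λ ())
third (suc zero)       (suc zero)       = zero , (λ ()) , (λ ())
third (suc zero)       (suc (suc zero)) = zero , (λ ()) , (λ ())
third (suc (suc zero)) zero             = suc zero , (λ ()) , (λ ())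
third (suc (suc zero)) (suc zero)       = zero , (λ ()) , (λ ())
third (suc (suc zero)) (suc (suc zero)) = zero , (λ ()) , (λ ())

glue : {V₁ V₂ : Set} → Rel V₁ 0ℓ → (V₁ → V₂ → Set) → Rel V₂ 0ℓ → Rel (V₁ ⊎ V₂) 0ℓ
glue E₁ C E₂ (inj₁ i) (inj₁ j) = E₁ i j
glue E₁ C E₂ (inj₁ i) (inj₂ j) = C i j
glue E₁ C E₂ (inj₂ i) (inj₁ j) = ⊥
glue E₁ C E₂ (inj₂ i) (inj₂ j) = E₂ i j

parallel : {V₁ V₂ : Set} → Rel V₁ 0ℓ → Rel V₂ 0ℓ → Rel (V₁ ⊎ V₂) 0ℓ
parallel E₁ E₂ = glue E₁ (λ _ _ → ⊥) E₂

series : {V₁ V₂ : Set} → Rel V₁ 0ℓ → Rel V₂ 0ℓ → Rel (V₁ ⊎ V₂) 0ℓ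
series E₁ E₂ = glue E₁ (λ i j → Sink E₁ i × Source E₂ j) E₂

module _ {V₁ V₂ : Set} (E₁ : Rel V₁ 0ℓ) (C : V₁ → V₂ → Set) (E₂ : Rel V₂ 0ℓ) where

  glue-hasSourceAndSink : ∃ (Source E₁) → ∃ (Sink E₂) → HasSourceAndSink (glue E₁ C E₂)
  glue-hasSourceAndSink (s , source-s) (t , sink-t) = (inj₁ s , source) , (inj₂ t , sink)
    where
    source : Source (glue E₁ C E₂) (inj₁ s)
    source (inj₁ v) = source-s v
    source (inj₂ v) ()
    sink : Sink (glue E₁ C E₂) (inj₂ t)
    sink (inj₁ w) ()
    sink (inj₂ w) = sink-t w

  glue-proper : ∀ {c₁ c₂} → Proper E₁ c₁ → Proper E₂ c₂ → (∀ i j → C i j → c₁ i ≢ c₂ j) →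
                Proper (glue E₁ C E₂) [ c₁ , c₂ ]′
  glue-proper proper₁ proper₂ cross (inj₁ i) (inj₁ j) = proper₁ i j
  glue-proper proper₁ proper₂ cross (inj₁ i) (inj₂ j) = cross i j
  glue-proper proper₁ proper₂ cross (inj₂ i) (inj₂ j) = proper₂ i j

module _ {V₁ V₂ : Set} {E₁ : Rel V₁ 0ℓ} {E₂ : Rel V₂ 0ℓ} where

  parallel-anchoredColourable : AnchoredColourable E₁ → AnchoredColourable E₂ →
                                AnchoredColourable (parallel E₁ E₂)
  parallel-anchoredColourable A₁ A₂ s≢t with A₁ s≢t | A₂ s≢t
  ... | c₁ , a₁ | c₂ , a₂ = [ c₁ , c₂ ]′ , record
    { proper  = glue-proper E₁ _ E₂ (proper a₁) (proper a₂) (λ _ _ ())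
    ; sources = λ { (inj₁ i) source → sources a₁ i (source ∘ inj₁)
                  ; (inj₂ j) source → sources a₂ j (source ∘ inj₂) }
    ; sinks   = λ { (inj₁ i) sink → sinks a₁ i (sink ∘ inj₁)
                  ; (inj₂ j) sink → sinks a₂ j (sink ∘ inj₂) }
    }

  series-anchoredColourable : ∃ (Sink E₁) → ∃ (Source E₂) →
                              AnchoredColourable E₁ → AnchoredColourable E₂ →
                              AnchoredColourable (series E₁ E₂)
  series-anchoredColourable (t₁ , sink-t₁) (s₂ , source-s₂) A₁ A₂ {s} {t} s≢t
    with third s t
  ... | z , z≢s , z≢t with A₁ (z≢s ∘ sym) | A₂ z≢t
  ... | c₁ , a₁ | c₂ , a₂ = [ c₁ , c₂ ]′ , record
    { proper  = glue-proper E₁ _ E₂ (proper a₁) (proper a₂)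
                  (λ i j (sink-i , source-j) c₁i≡c₂j →
                     sinks a₁ i sink-i (trans c₁i≡c₂j (sources a₂ j source-j)))
    ; sources = λ { (inj₁ i) source → sources a₁ i (source ∘ inj₁)
                  ; (inj₂ j) source → ⊥-elim (source (inj₁ t₁) (sink-t₁ , source ∘ inj₂)) }
    ; sinks   = λ { (inj₁ i) sink → ⊥-elim (sink (inj₂ s₂) (sink ∘ inj₁ , source-s₂))
                  ; (inj₂ j) sink → sinks a₂ j (sink ∘ inj₂) }
    }

module Relabel {V W : Set} {E : Rel V 0ℓ} {E′ : Rel W 0ℓ} (σ : V ↔ W)
               (σ-arc : ∀ i j → E′ (Inverse.to σ i) (Inverse.to σ j) ⇔ E i j) where
  open Inverse σ

  arc-from : ∀ {u v} → E′ u v → E (from u) (from v)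
  arc-from {u} {v} e = Equivalence.to (σ-arc (from u) (from v))
    (subst₂ E′ (sym (strictlyInverseˡ u)) (sym (strictlyInverseˡ v)) e)

  arc-to : ∀ {i j} → E i j → E′ (to i) (to j)
  arc-to {i} {j} = Equivalence.from (σ-arc i j)

  source-to : ∀ {i} → Source E i → Source E′ (to i)
  source-to {i} source v e = source (from v) (subst (E (from v)) (strictlyInverseʳ i) (arc-from e))

  sink-to : ∀ {i} → Sink E i → Sink E′ (to i)
  sink-to {i} sink w e = sink (from w) (subst (λ x → E x (from w)) (strictlyInverseʳ i) (arc-from e))

  source-from : ∀ {w} → Source E′ w → Source E (from w)
  source-from {w} source v e = source (to v) (subst (E′ (to v)) (strictlyInverseˡ w) (arc-to e))

  sink-from : ∀ {v} → Sink E′ v → Sink E (from v)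
  sink-from {v} sink w e = sink (to w) (subst (λ x → E′ x (to w)) (strictlyInverseˡ v) (arc-to e))

  hasSourceAndSink : HasSourceAndSink E → HasSourceAndSink E′
  hasSourceAndSink ((s , source) , (t , sink)) = (to s , source-to source) , (to t , sink-to sink)

  anchoredColourable : AnchoredColourable E → AnchoredColourable E′
  anchoredColourable A s≢t with A s≢t
  ... | c , a = c ∘ from , record
    { proper  = λ u v → proper a (from u) (from v) ∘ arc-from
    ; sources = λ w → sources a (from w) ∘ source-from
    ; sinks   = λ v → sinks a (from v) ∘ sink-from
    }

module _ {m n : ℕ} (E₁ : Digraph m) (E₂ : Digraph n) where

  join↔ : (Fin m ⊎ Fin n) ↔ Fin (m + n)
  join↔ = ↔-sym +↔⊎

  ∪ᵈ-join : ∀ a b → (E₁ ∪ᵈ E₂) (join m n a) (join m n b) ⇔ parallel E₁ E₂ a b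
  ∪ᵈ-join a b rewrite splitAt-join m n a | splitAt-join m n b with a | b
  ... | inj₁ i | inj₁ j = ⇔-id _
  ... | inj₁ i | inj₂ j = ⇔-id _
  ... | inj₂ i | inj₁ j = ⇔-id _
  ... | inj₂ i | inj₂ j = ⇔-id _

  ×ᵈ-join : ∀ a b → (E₁ ×ᵈ E₂) (join m n a) (join m n b) ⇔ series E₁ E₂ a b
  ×ᵈ-join a b rewrite splitAt-join m n a | splitAt-join m n b with a | b
  ... | inj₁ i | inj₁ j = ⇔-id _
  ... | inj₁ i | inj₂ j = ⇔-id _
  ... | inj₂ i | inj₁ j = ⇔-id _
  ... | inj₂ i | inj₂ j = ⇔-id _

msp-hasSourceAndSink : ∀ {n E} → MSP n E → HasSourceAndSink E
msp-hasSourceAndSink msp-single = (zero , λ _ ()) , (zero , λ _ ())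
msp-hasSourceAndSink (msp-par {E₁ = E₁} {E₂} G₁ G₂) =
  Relabel.hasSourceAndSink (join↔ E₁ E₂) (∪ᵈ-join E₁ E₂)
    (glue-hasSourceAndSink E₁ _ E₂ (proj₁ (msp-hasSourceAndSink G₁)) (proj₂ (msp-hasSourceAndSink G₂)))
msp-hasSourceAndSink (msp-ser {E₁ = E₁} {E₂} G₁ G₂) =
  Relabel.hasSourceAndSink (join↔ E₁ E₂) (×ᵈ-join E₁ E₂)
    (glue-hasSourceAndSink E₁ _ E₂ (proj₁ (msp-hasSourceAndSink G₁)) (proj₂ (msp-hasSourceAndSink G₂)))
msp-hasSourceAndSink (msp-iso G σ σ-arc) = Relabel.hasSourceAndSink σ σ-arc (msp-hasSourceAndSink G)

msp-anchoredColourable : ∀ {n E} → MSP n E → AnchoredColourable E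
msp-anchoredColourable msp-single {s} s≢t =
  (λ _ → s) , record { proper = λ _ _ () ; sources = λ _ _ → refl ; sinks = λ _ _ → s≢t }
msp-anchoredColourable (msp-par {E₁ = E₁} {E₂} G₁ G₂) =
  Relabel.anchoredColourable (join↔ E₁ E₂) (∪ᵈ-join E₁ E₂)
    (parallel-anchoredColourable (msp-anchoredColourable G₁) (msp-anchoredColourable G₂))
msp-anchoredColourable (msp-ser {E₁ = E₁} {E₂} G₁ G₂) =
  Relabel.anchoredColourable (join↔ E₁ E₂) (×ᵈ-join E₁ E₂)
    (series-anchoredColourable (proj₂ (msp-hasSourceAndSink G₁)) (proj₁ (msp-hasSourceAndSink G₂))
      (msp-anchoredColourable G₁) (msp-anchoredColourable G₂))
msp-anchoredColourable (msp-iso G σ σ-arc) = Relabel.anchoredColourable σ σ-arc (msp-anchoredColourable G)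

proper-un : ∀ {n} {E : Digraph n} {c} → Proper E c → ProperColouring 3 (un E) c
proper-un proper u v (inj₁ e) = proper u v e
proper-un proper u v (inj₂ e) = proper v u e ∘ sym

proposition5p12 : ∀ (n : ℕ) (E : Digraph n) → MSP n E → χ≤ (un E) 3
proposition5p12 n E G with msp-anchoredColourable G {zero} {suc zero} (λ ())
... | c , a = c , proper-un (proper a)
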